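{- Let $k$ be a positive integer with $k\equiv 2 \pmod 5$. Then $va_3^{\equiv}(K_{4k,4k,4k})\geq \frac{12k+6}{5}$.
   Context: All graphs are finite and simple. A $t$-coloring of a graph $G$ is a map $f:V(G)\to\{1,\dots,t\}$, with color classes $V_i=\{v: f(v)=i\}$. It is equitable if $\big||V_i|-|V_j|\big|\le 1$ for all $i,j$. A $(t,k)$-tree-coloring of $G$ is a $t$-coloring such that every connected component of each induced subgraph $G[V_i]$ is a tree of maximum degree at most $k$; an equitable $(t,k)$-tree-coloring is a $(t,k)$-tree-coloring that is equitable. The strong equitable vertex $k$-arboricity $va_k^{\equiv}(G)$ is the smallest integer $t$ such that $G$ has an equitable $(t',k)$-tree-coloring for every integer $t'\ge t$. $K_{n,n,n}$ denotes the complete tripartite graph whose three partite sets each have exactly $n$ vertices. -}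

module Defs where

open import Data.Nat using (ℕ; zero; suc; _+_; _*_; _≤_)
open import Data.Fin using (Fin; zero; suc; inject₁; fromℕ; quotient; _≟_)
open import Data.Bool using (Bool; T; not; _∧_)
open import Data.List using (List; length; filter; allFin)
open import Data.Product using (_×_)
open import Relation.Nullary using (¬_)
open import Relation.Nullary.Decidable using (⌊_⌋)
open import Relation.Binary.PropositionalEquality using (_≡_)
open import Function.Definitions using (Injective)

record Graph : Set where
  field
    N      : ℕ
    adj    : Fin N → Fin N → Bool
    adj-sym    : ∀ u v → adj u v ≡ adj v u
    adj-irrefl : ∀ v → adj v v ≡ Data.Bool.false
open Graph public

Adj : (G : Graph) → Fin (N G) → Fin (N G) → Set
Adj G u v = T (adj G u v)

Coloring : Graph → ℕ → Set
Coloring G t = Fin (N G) → Fin t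

classSize : (G : Graph) {t : ℕ} → Coloring G t → Fin t → ℕ
classSize G f i = length (filter (λ v → f v ≟ i) (allFin (N G)))

Equitable : (G : Graph) {t : ℕ} → Coloring G t → Set
Equitable G f = ∀ i j → classSize G f i ≤ suc (classSize G f j)

inducedDeg : (G : Graph) {t : ℕ} → Coloring G t → Fin (N G) → ℕ
inducedDeg G f v =
  length (filter (λ u → Data.Bool._≟_ (adj G v u ∧ ⌊ f u ≟ f v ⌋) Data.Bool.true)
                 (allFin (N G)))

record MonoCycle (G : Graph) {t : ℕ} (f : Coloring G t) (c : Fin t) : Set where
  field
    m     : ℕ
    vs    : Fin (suc (suc (suc m))) → Fin (N G)
    inj   : Injective _≡_ _≡_ vs
    step  : ∀ (i : Fin (suc (suc m))) → Adj G (vs (inject₁ i)) (vs (suc i))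
    close : Adj G (vs (fromℕ (suc (suc m)))) (vs zero)
    col   : ∀ i → f (vs i) ≡ c

-- (t,k)-tree-coloring: every component of every G[V_i] is a tree (i.e. each
-- G[V_i] is acyclic) of maximum degree at most k.
TreeColoring : (G : Graph) {t : ℕ} → Coloring G t → ℕ → Set
TreeColoring G {t} f k =
  (∀ (c : Fin t) → ¬ MonoCycle G f c) × (∀ v → inducedDeg G f v ≤ k)

HasEqTreeColoring : Graph → ℕ → ℕ → Set
HasEqTreeColoring G t k =
  Data.Product.Σ (Coloring G t) (λ f → Equitable G f × TreeColoring G f k)

-- t belongs to the set whose minimum is va_k^≡(G):
-- G has an equitable (t',k)-tree-coloring for every t' ≥ t.
StrongEqBound : Graph → ℕ → ℕ → Set
StrongEqBound G k t = ∀ t' → t ≤ t' → HasEqTreeColoring G t' k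

private
  open import Relation.Nullary using (yes; no)
  open import Relation.Binary.PropositionalEquality as PE using (refl)
  open import Data.Empty using (⊥-elim)

  neq-sym : ∀ {m} (a b : Fin m) → not ⌊ a ≟ b ⌋ ≡ not ⌊ b ≟ a ⌋
  neq-sym a b with a ≟ b | b ≟ a
  ... | yes _ | yes _ = refl
  ... | no _  | no _  = refl
  ... | yes p | no q  = ⊥-elim (q (PE.sym p))
  ... | no p  | yes q = ⊥-elim (p (PE.sym q))

  neq-irr : ∀ {m} (a : Fin m) → not ⌊ a ≟ a ⌋ ≡ Data.Bool.false
  neq-irr a with a ≟ a
  ... | yes _ = refl
  ... | no q  = ⊥-elim (q refl)

-- complete tripartite graph K_{n,n,n}: vertex v ∈ Fin (3 * n) lies in part
-- quotient n v ∈ Fin 3; two vertices are adjacent iff their parts differ.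
Ktri : ℕ → Graph
Ktri n = record
  { N = 3 * n
  ; adj = λ u v → not ⌊ quotient {3} n u ≟ quotient n v ⌋
  ; adj-sym = λ u v → neq-sym (quotient {3} n u) (quotient n v)
  ; adj-irrefl = λ v → neq-irr (quotient {3} n v)
  }

-- Suppose f is an equitable (T,3)-tree-colouring of K_{n,n,n} with n ≡ 3 (mod 5) and 3n + 1 = 5T
-- (for n = 4k with k ≡ 2 (mod 5) this T is (12k + 6)/5 − 1). Let a c p count the vertices of colour c
-- in part p. Since 3n = 5T − 1, equitability forces every class to have at most 5 vertices. A class
-- meeting all three parts contains a triangle, and a class meeting two parts induces a complete
-- bipartite graph, which is a forest of maximum degree 3 only with at most 4 vertices; so a class of
-- size 5 lies inside a single part. Let r c = Σ_p (a c p mod 5). Then r c + 4·|V_c| ≤ 20 for every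
-- class (r c = 0 if |V_c| = 5, and r c ≤ |V_c| ≤ 4 otherwise), and summing over the T classes gives
-- Σ_c r c ≤ 20T − 4·3n = 4. On the other hand every part has n ≡ 3 (mod 5) vertices, so its residues
-- sum to at least 3, and Σ_c r c ≥ 9. So no t ≤ T bounds the strong equitable 3-arboricity, and it is at
-- least T + 1 = (12k + 6)/5.

module Submission where

open import Data.Bool using (Bool; true; false; _∧_)
import Data.Bool as Bool
open import Data.Bool.Properties using (∧-comm; T-≡; T-∧)
open import Data.Empty using (⊥; ⊥-elim)
open import Data.Fin using (Fin; zero; suc; _↑ˡ_; _↑ʳ_; quotient; _≟_; inject₁; fromℕ)
open import Data.Fin.Patterns using (0F; 1F; 2F; 3F)
open import Data.Fin.Properties using (splitAt-↑ˡ; splitAt-↑ʳ; suc-injective; ¬∀⟶∃¬)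
open import Data.List using (length; filter; tabulate)
open import Data.Nat using (ℕ; zero; suc; _+_; _*_; _≤_; _<_; _%_; _/_; _≤?_; z≤n; s≤s; NonZero)
open import Data.Nat.DivMod using (m≡m%n+[m/n]*n; %-distribˡ-+; %-distribˡ-*; m%n%n≡m%n; m%n≤m)
open import Data.Nat.Properties
  using (+-0-commutativeMonoid; +-*-semiring; +-commutativeSemigroup; module ≤-Reasoning;
         ≤-refl; ≤-reflexive; ≤-trans; ≤-pred; ≰⇒>; <⇒≱; <-irrefl; n≤1+n; n<1+n;
         m≤n⇒m<n∨m≡n;
         +-assoc; +-comm; +-identityʳ; *-comm; *-assoc; *-zeroʳ; *-identityʳ; *-distribˡ-+;
         +-mono-≤; +-monoˡ-≤; *-monoˡ-≤; *-monoʳ-≤; +-cancelʳ-≤)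
open import Data.Nat.Tactic.RingSolver using (solve-∀)
open import Data.Product using (_×_; _,_; proj₁; proj₂; map; map₂; ∃; ∃₂)
open import Data.Sum using (inj₁; inj₂)
open import Data.Vec using (Vec; []; _∷_; lookup)
open import Data.Vec.Relation.Unary.All using ([]; _∷_)
open import Data.Vec.Relation.Unary.AllPairs using ([]; _∷_)
open import Data.Vec.Relation.Unary.Unique.Propositional using (Unique)
open import Data.Vec.Relation.Unary.Unique.Propositional.Properties using (lookup-injective)
open import Defs
open import Function using (_∘_; id)
open import Function.Bundles using (Equivalence)
open import Level using (0ℓ)
open import Relation.Binary.PropositionalEquality
open import Relation.Nullary using (¬_; yes; no; does; contradiction; _×-dec_)
open import Relation.Nullary.Decidable using (⌊_⌋; fromWitness; fromWitnessFalse)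
open import Relation.Unary using (Pred; Decidable; _⊆_)
open import Algebra.Properties.CommutativeMonoid.Sum +-0-commutativeMonoid
  using (sum; sum-syntax; sum-cong-≗; sum-replicate-zero; ∑-distrib-+; ∑-comm)
open import Algebra.Properties.CommutativeSemigroup +-commutativeSemigroup
  using (x∙yz≈y∙xz; x∙yz≈z∙xy)
open import Algebra.Properties.Semiring.Sum +-*-semiring using (*-distribˡ-sum)

χ : Bool → ℕ
χ true  = 1
χ false = 0

∑-mono-≤ : ∀ {N} {f g : Fin N → ℕ} → (∀ i → f i ≤ g i) → sum f ≤ sum g
∑-mono-≤ {zero}  f≤g = z≤n
∑-mono-≤ {suc N} f≤g = +-mono-≤ (f≤g zero) (∑-mono-≤ (f≤g ∘ suc))

∑-const : ∀ N x → ∑[ i < N ] x ≡ N * x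
∑-const zero    x = refl
∑-const (suc N) x = cong (x +_) (∑-const N x)

∑-split : ∀ a b (f : Fin (a + b) → ℕ) →
  sum f ≡ ∑[ i < a ] f (i ↑ˡ b) + ∑[ j < b ] f (a ↑ʳ j)
∑-split zero    b f = refl
∑-split (suc a) b f = trans (cong (f zero +_) (∑-split a b (f ∘ suc))) (sym (+-assoc (f zero) _ _))

∑-quotient : ∀ m n (g : Fin m → ℕ) → ∑[ v < m * n ] g (quotient n v) ≡ n * sum g
∑-quotient zero    n g = sym (*-zeroʳ n)
∑-quotient (suc m) n g = begin
  ∑[ v < suc m * n ] g (quotient n v)
    ≡⟨ ∑-split n (m * n) _ ⟩
  ∑[ i < n ] g (quotient n (i ↑ˡ (m * n))) + ∑[ j < m * n ] g (quotient n (n ↑ʳ j))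
    ≡⟨ cong₂ _+_ (sum-cong-≗ (λ i → cong g (quotient-↑ˡ i)))
                 (sum-cong-≗ (λ j → cong g (quotient-↑ʳ j))) ⟩
  ∑[ i < n ] g zero + ∑[ j < m * n ] g (suc (quotient n j))
    ≡⟨ cong₂ _+_ (∑-const n (g zero)) (∑-quotient m n (g ∘ suc)) ⟩
  n * g zero + n * sum (g ∘ suc)
    ≡⟨ *-distribˡ-+ n (g zero) _ ⟨
  n * sum g ∎
  where
  open ≡-Reasoning
  quotient-↑ˡ : ∀ i → quotient {suc m} n (i ↑ˡ (m * n)) ≡ zero
  quotient-↑ˡ i rewrite splitAt-↑ˡ n i (m * n) = refl
  quotient-↑ʳ : ∀ j → quotient {suc m} n (n ↑ʳ j) ≡ suc (quotient {m} n j)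
  quotient-↑ʳ j rewrite splitAt-↑ʳ n (m * n) j = refl

∑-% : ∀ {N} d .{{_ : NonZero d}} (f : Fin N → ℕ) → sum f % d ≡ ∑[ i < N ] (f i % d) % d
∑-% {zero}  d f = refl
∑-% {suc N} d f = begin
  (f zero + sum (f ∘ suc)) % d                       ≡⟨ %-distribˡ-+ (f zero) _ d ⟩
  (f zero % d + sum (f ∘ suc) % d) % d               ≡⟨ cong₂ (λ x y → (x + y) % d)
                                                          (sym (m%n%n≡m%n (f zero) d)) (∑-% d (f ∘ suc)) ⟩
  (f zero % d % d + ∑[ i < N ] (f (suc i) % d) % d) % d ≡⟨ %-distribˡ-+ (f zero % d) _ d ⟨
  ∑[ i < suc N ] (f i % d) % d                       ∎
  where open ≡-Reasoning

∑<*⇒∃< : ∀ {N} (f : Fin N → ℕ) x → sum f < N * x → ∃ λ i → f i < x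
∑<*⇒∃< {N} f x ∑f<Nx =
  map₂ ≰⇒> (¬∀⟶∃¬ N (λ i → x ≤ f i) (λ i → x ≤? f i) not-all-≥)
  where
  not-all-≥ : ¬ (∀ i → x ≤ f i)
  not-all-≥ x≤f = <⇒≱ ∑f<Nx (subst (_≤ sum f) (∑-const N x) (∑-mono-≤ x≤f))

count : ∀ {N ℓ} {P : Pred (Fin N) ℓ} → Decidable P → ℕ
count P? = ∑[ i < _ ] χ (does (P? i))

length-filter-tabulate : ∀ {A : Set} {N ℓ} {P : Pred A ℓ} (P? : Decidable P) (g : Fin N → A) →
  length (filter P? (tabulate g)) ≡ ∑[ i < N ] χ (does (P? (g i)))
length-filter-tabulate {N = zero}  P? g = refl
length-filter-tabulate {N = suc N} P? g with does (P? (g zero))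
... | true  = cong suc (length-filter-tabulate P? (g ∘ suc))
... | false = length-filter-tabulate P? (g ∘ suc)

count-≟ˡ : ∀ {N} (x : Fin N) → count (x ≟_) ≡ 1
count-≟ˡ {suc N} zero    = cong suc (sum-replicate-zero N)
count-≟ˡ {suc N} (suc x) = count-≟ˡ x

count-≟ʳ : ∀ {N} (x : Fin N) → count (_≟ x) ≡ 1
count-≟ʳ {suc N} zero    = cong suc (sum-replicate-zero N)
count-≟ʳ {suc N} (suc x) = count-≟ʳ x

count-partition : ∀ {N t ℓ} {P : Pred (Fin N) ℓ} (P? : Decidable P) (g : Fin N → Fin t) →
  count P? ≡ ∑[ c < t ] count (λ i → P? i ×-dec g i ≟ c)
count-partition {N} {t} P? g = begin
  ∑[ i < N ] χ (does (P? i))                ≡⟨ sum-cong-≗ (λ i → split (does (P? i)) (g i)) ⟨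
  ∑[ i < N ] ∑[ c < t ] χ (P?∧g≟ i c)        ≡⟨ ∑-comm χ∘P?∧g≟ ⟩
  ∑[ c < t ] ∑[ i < N ] χ (P?∧g≟ i c)        ∎
  where
  open ≡-Reasoning
  P?∧g≟ : Fin N → Fin t → Bool
  P?∧g≟ i c = does (P? i) ∧ does (g i ≟ c)
  χ∘P?∧g≟ : Fin N → Fin t → ℕ
  χ∘P?∧g≟ i c = χ (P?∧g≟ i c)
  split : ∀ b (x : Fin t) → ∑[ c < t ] χ (b ∧ does (x ≟ c)) ≡ χ b
  split false x = sum-replicate-zero t
  split true  x = count-≟ˡ x

count-mono-≤ : ∀ {N ℓ} {P Q : Pred (Fin N) ℓ} (P? : Decidable P) (Q? : Decidable Q) →
  P ⊆ Q → count P? ≤ count Q?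
count-mono-≤ P? Q? P⊆Q = ∑-mono-≤ χ-mono
  where
  χ-mono : ∀ i → χ (does (P? i)) ≤ χ (does (Q? i))
  χ-mono i with P? i | Q? i
  ... | yes Pi | no ¬Qi = contradiction (P⊆Q Pi) ¬Qi
  ... | yes _  | yes _  = ≤-refl
  ... | no _   | _      = z≤n

1≤count⇒∃ : ∀ {N ℓ} {P : Pred (Fin N) ℓ} (P? : Decidable P) → 1 ≤ count P? → ∃ P
1≤count⇒∃ {suc N} P? 1≤c with P? zero
... | yes P0 = zero , P0
... | no _   = map suc id (1≤count⇒∃ (P? ∘ suc) 1≤c)

2≤count⇒∃₂ : ∀ {N ℓ} {P : Pred (Fin N) ℓ} (P? : Decidable P) → 2 ≤ count P? →
  ∃₂ λ i j → i ≢ j × P i × P j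
2≤count⇒∃₂ {suc N} P? 2≤c with P? zero
... | yes P0 = let i , Pi = 1≤count⇒∃ (P? ∘ suc) (≤-pred 2≤c) in zero , suc i , (λ ()) , P0 , Pi
... | no _   = let i , j , i≢j , Pi , Pj = 2≤count⇒∃₂ (P? ∘ suc) 2≤c in
               suc i , suc j , i≢j ∘ suc-injective , Pi , Pj

no-balanced-matrix : ∀ {T m} n (a : Fin T → Fin m → ℕ) →
  2 ≤ m → n % 5 ≡ 3 → m * n + 1 ≡ 5 * T →
  (∀ p → ∑[ c < T ] a c p ≡ n) →
  (∀ c d → sum (a c) ≤ suc (sum (a d))) →
  (∀ c → sum (a c) ≡ 5 → ∀ p → a c p % 5 ≡ 0) → ⊥
no-balanced-matrix {T} {m} n a 2≤m n%5≡3 size columns balanced fives =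
  <-irrefl refl (begin-strict
    4      <⟨ n<1+n 4 ⟩
    5      ≤⟨ n≤1+n 5 ⟩
    2 * 3  ≤⟨ *-monoˡ-≤ 3 2≤m ⟩
    m * 3  ≤⟨ m*3≤∑r ⟩
    sum r  ≤⟨ ∑r≤4 ⟩
    4      ∎)
  where
  open ≤-Reasoning
  s r : Fin T → ℕ
  s c = sum (a c)
  r c = ∑[ p < m ] (a c p % 5)

  ∑s≡mn : sum s ≡ m * n
  ∑s≡mn = trans (∑-comm a) (trans (sum-cong-≗ columns) (∑-const m n))

  s≤5 : ∀ c → s c ≤ 5
  s≤5 c = let c₀ , s₀<5 = ∑<*⇒∃< s 5 ∑s<T*5 in ≤-trans (balanced c c₀) s₀<5
    where
    ∑s<T*5 : sum s < T * 5
    ∑s<T*5 = ≤-reflexive (trans (cong suc ∑s≡mn) (trans (+-comm 1 (m * n)) (trans size (*-comm 5 T))))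

  row-bound : ∀ c → r c + 4 * s c ≤ 20
  row-bound c with m≤n⇒m<n∨m≡n (s≤5 c)
  ... | inj₂ s≡5 = ≤-reflexive (cong₂ (λ x y → x + 4 * y)
                     (trans (sum-cong-≗ (fives c s≡5)) (sum-replicate-zero m)) s≡5)
  ... | inj₁ s<5 = ≤-trans (+-monoˡ-≤ (4 * s c) (∑-mono-≤ (λ p → m%n≤m (a c p) 5)))
                           (*-monoʳ-≤ 5 (≤-pred s<5))

  ∑r≤4 : sum r ≤ 4
  ∑r≤4 = +-cancelʳ-≤ (4 * (m * n)) (sum r) 4 (begin
    sum r + 4 * (m * n)              ≡⟨ cong (λ x → sum r + 4 * x) ∑s≡mn ⟨
    sum r + 4 * sum s                ≡⟨ cong (sum r +_) (*-distribˡ-sum 4 s) ⟩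
    sum r + ∑[ c < T ] (4 * s c)     ≡⟨ ∑-distrib-+ r (λ c → 4 * s c) ⟨
    ∑[ c < T ] (r c + 4 * s c)       ≤⟨ ∑-mono-≤ row-bound ⟩
    ∑[ c < T ] 20                    ≡⟨ ∑-const T 20 ⟩
    T * 20                           ≡⟨ trans (*-comm T 20) (*-assoc 4 5 T) ⟩
    4 * (5 * T)                      ≡⟨ cong (4 *_) size ⟨
    4 * (m * n + 1)                  ≡⟨ *-distribˡ-+ 4 (m * n) 1 ⟩
    4 * (m * n) + 4                  ≡⟨ +-comm (4 * (m * n)) 4 ⟩
    4 + 4 * (m * n)                  ∎)

  column-residue : ∀ p → 3 ≤ ∑[ c < T ] (a c p % 5)
  column-residue p = subst (_≤ ∑[ c < T ] (a c p % 5)) residue≡3 (m%n≤m _ 5)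
    where
    residue≡3 : (∑[ c < T ] (a c p % 5)) % 5 ≡ 3
    residue≡3 = trans (sym (∑-% 5 (λ c → a c p))) (trans (cong (_% 5) (columns p)) n%5≡3)

  m*3≤∑r : m * 3 ≤ sum r
  m*3≤∑r = begin
    m * 3                            ≡⟨ ∑-const m 3 ⟨
    ∑[ p < m ] 3                     ≤⟨ ∑-mono-≤ column-residue ⟩
    ∑[ p < m ] ∑[ c < T ] (a c p % 5) ≡⟨ ∑-comm (λ c p → a c p % 5) ⟨
    sum r                            ∎

all-or-nothing : ∀ x y z → x + (y + z) ≡ 5 → (1 ≤ x → 1 ≤ y → 1 ≤ z → ⊥) →
  (1 ≤ x → 1 ≤ y → x + y ≤ 4) → (1 ≤ x → 1 ≤ z → x + z ≤ 4) → x % 5 ≡ 0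
all-or-nothing zero      _         _         _       _       _     _     = refl
all-or-nothing x@(suc _) zero      zero      x+0+0≡5 _       _     _     =
  cong (_% 5) (trans (sym (+-identityʳ x)) x+0+0≡5)
all-or-nothing x@(suc _) y@(suc _) zero      x+y+0≡5 _       x+y≤4 _     =
  ⊥-elim (<-irrefl refl (subst (_≤ 4) x+y≡5 (x+y≤4 (s≤s z≤n) (s≤s z≤n))))
  where
  x+y≡5 : x + y ≡ 5
  x+y≡5 = trans (cong (x +_) (sym (+-identityʳ y))) x+y+0≡5
all-or-nothing (suc _)   zero      (suc _)   x+z≡5   _       _     x+z≤4 =
  ⊥-elim (<-irrefl refl (subst (_≤ 4) x+z≡5 (x+z≤4 (s≤s z≤n) (s≤s z≤n))))
all-or-nothing (suc _)   (suc _)   (suc _)   _       rainbow _     _     =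
  ⊥-elim (rainbow (s≤s z≤n) (s≤s z≤n) (s≤s z≤n))

part : ∀ n → Fin (3 * n) → Fin 3
part n = quotient n

part-size : ∀ n (p : Fin 3) → count (λ v → part n v ≟ p) ≡ n
part-size n p = begin
  count (λ v → part n v ≟ p) ≡⟨ ∑-quotient 3 n (λ i → χ (does (i ≟ p))) ⟩
  n * count (_≟ p)           ≡⟨ cong (n *_) (count-≟ʳ p) ⟩
  n * 1                      ≡⟨ *-identityʳ n ⟩
  n                          ∎
  where open ≡-Reasoning

module _ {n t} (f : Coloring (Ktri n) t) where

  Cell : Fin t → Fin 3 → Pred (Fin (3 * n)) 0ℓ
  Cell c p v = f v ≡ c × part n v ≡ p

  cell? : ∀ c p → Decidable (Cell c p)
  cell? c p v = f v ≟ c ×-dec part n v ≟ p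

  cellSize : Fin t → Fin 3 → ℕ
  cellSize c p = count (cell? c p)

  cell-inhabited : ∀ {c p} → 1 ≤ cellSize c p → ∃ (Cell c p)
  cell-inhabited {c} {p} = 1≤count⇒∃ (cell? c p)

  classSize≡∑cellSize : ∀ c → classSize (Ktri n) f c ≡ sum (cellSize c)
  classSize≡∑cellSize c =
    trans (length-filter-tabulate (λ v → f v ≟ c) id) (count-partition (λ v → f v ≟ c) (part n))

  ∑cellSize≡n : ∀ p → ∑[ c < t ] cellSize c p ≡ n
  ∑cellSize≡n p = begin
    ∑[ c < t ] cellSize c p
      ≡⟨ sum-cong-≗ (λ c → sum-cong-≗ (λ v → cong χ (∧-comm (does (f v ≟ c)) _))) ⟩
    ∑[ c < t ] count (λ v → part n v ≟ p ×-dec f v ≟ c)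
      ≡⟨ count-partition (λ v → part n v ≟ p) f ⟨
    count (λ v → part n v ≟ p)
      ≡⟨ part-size n p ⟩
    n ∎
    where open ≡-Reasoning

  adjacent : ∀ {c c′ p q u v} → Cell c p u → Cell c′ q v → p ≢ q → Adj (Ktri n) u v
  adjacent (_ , refl) (_ , refl) = fromWitnessFalse

  distinct : ∀ {c c′ p q u v} → Cell c p u → Cell c′ q v → p ≢ q → u ≢ v
  distinct (_ , refl) (_ , refl) p≢q refl = p≢q refl

  mono-cycle : ∀ {c m} (vs : Vec (Fin (3 * n)) (3 + m)) (ps : Vec (Fin 3) (3 + m)) → Unique vs →
    (∀ i → Cell c (lookup ps i) (lookup vs i)) →
    (∀ i → lookup ps (inject₁ i) ≢ lookup ps (suc i)) →
    lookup ps (fromℕ (2 + m)) ≢ lookup ps zero →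
    MonoCycle (Ktri n) f c
  mono-cycle vs ps unique cells steps closing = record
    { vs    = lookup vs
    ; inj   = λ {i} {j} → lookup-injective unique i j
    ; step  = λ i → adjacent (cells _) (cells _) (steps i)
    ; close = adjacent (cells _) (cells zero) closing
    ; col   = proj₁ ∘ cells
    }

  triangle : ∀ {c u₀ u₁ u₂} → Cell c 0F u₀ → Cell c 1F u₁ → Cell c 2F u₂ →
    MonoCycle (Ktri n) f c
  triangle {u₀ = u₀} {u₁} {u₂} c₀ c₁ c₂ =
    mono-cycle (u₀ ∷ u₁ ∷ u₂ ∷ []) (0F ∷ 1F ∷ 2F ∷ [])
      ((distinct c₀ c₁ (λ ()) ∷ distinct c₀ c₂ (λ ()) ∷ [])
       ∷ (distinct c₁ c₂ (λ ()) ∷ [])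
       ∷ [] ∷ [])
      (λ { 0F → c₀ ; 1F → c₁ ; 2F → c₂ })
      (λ { 0F → λ () ; 1F → λ () })
      (λ ())

  square : ∀ {c p q u₁ u₂ w₁ w₂} → p ≢ q → u₁ ≢ u₂ → w₁ ≢ w₂ →
    Cell c p u₁ → Cell c p u₂ → Cell c q w₁ → Cell c q w₂ → MonoCycle (Ktri n) f c
  square {p = p} {q} {u₁} {u₂} {w₁} {w₂} p≢q u₁≢u₂ w₁≢w₂ cu₁ cu₂ cw₁ cw₂ =
    mono-cycle (u₁ ∷ w₁ ∷ u₂ ∷ w₂ ∷ []) (_ ∷ _ ∷ _ ∷ _ ∷ [])
      ((distinct cu₁ cw₁ p≢q ∷ u₁≢u₂ ∷ distinct cu₁ cw₂ p≢q ∷ [])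
       ∷ (distinct cw₁ cu₂ q≢p ∷ w₁≢w₂ ∷ [])
       ∷ (distinct cu₂ cw₂ p≢q ∷ [])
       ∷ [] ∷ [])
      (λ { 0F → cu₁ ; 1F → cw₁ ; 2F → cu₂ ; 3F → cw₂ })
      (λ { 0F → p≢q ; 1F → q≢p ; 2F → p≢q })
      q≢p
    where
    q≢p : q ≢ p
    q≢p = p≢q ∘ sym

  cellSize≤inducedDeg : ∀ {c p q v} → Cell c p v → p ≢ q → cellSize c q ≤ inducedDeg (Ktri n) f v
  cellSize≤inducedDeg {c} {p} {q} {v} cv p≢q = begin
    cellSize c q            ≤⟨ count-mono-≤ (cell? c q) deg? same-coloured-neighbour ⟩
    count deg?              ≡⟨ length-filter-tabulate deg? id ⟨
    inducedDeg (Ktri n) f v ∎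
    where
    open ≤-Reasoning
    SameColouredNeighbour : Pred (Fin (3 * n)) 0ℓ
    SameColouredNeighbour u = (adj (Ktri n) v u ∧ ⌊ f u ≟ f v ⌋) ≡ true
    deg? : Decidable SameColouredNeighbour
    deg? u = (adj (Ktri n) v u ∧ ⌊ f u ≟ f v ⌋) Bool.≟ true
    same-coloured-neighbour : Cell c q ⊆ SameColouredNeighbour
    same-coloured-neighbour cu = Equivalence.to T-≡ (Equivalence.from T-∧
      (adjacent cv cu p≢q , fromWitness (trans (proj₁ cu) (sym (proj₁ cv)))))

  module _ (tree : TreeColoring (Ktri n) f 3) where

    cell-≤3 : ∀ {c p q} → p ≢ q → 1 ≤ cellSize c p → cellSize c q ≤ 3
    cell-≤3 p≢q 1≤cp =
      let v , cv = cell-inhabited 1≤cp in ≤-trans (cellSize≤inducedDeg cv p≢q) (proj₂ tree v)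

    two-cells-≤4 : ∀ {c p q} → p ≢ q → 1 ≤ cellSize c p → 1 ≤ cellSize c q →
      cellSize c p + cellSize c q ≤ 4
    two-cells-≤4 {c} {p} {q} p≢q 1≤cp 1≤cq with 2 ≤? cellSize c p | 2 ≤? cellSize c q
    ... | yes 2≤cp | yes 2≤cq =
      let u₁ , u₂ , u₁≢u₂ , cu₁ , cu₂ = 2≤count⇒∃₂ (cell? c p) 2≤cp
          w₁ , w₂ , w₁≢w₂ , cw₁ , cw₂ = 2≤count⇒∃₂ (cell? c q) 2≤cq
      in ⊥-elim (proj₁ tree c (square p≢q u₁≢u₂ w₁≢w₂ cu₁ cu₂ cw₁ cw₂))
    ... | no 2≰cp  | _        = +-mono-≤ (≤-pred (≰⇒> 2≰cp)) (cell-≤3 p≢q 1≤cp)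
    ... | yes _    | no 2≰cq  = +-mono-≤ (cell-≤3 (p≢q ∘ sym) 1≤cq) (≤-pred (≰⇒> 2≰cq))

    not-rainbow : ∀ c → 1 ≤ cellSize c 0F → 1 ≤ cellSize c 1F → 1 ≤ cellSize c 2F → ⊥
    not-rainbow c 1≤c₀ 1≤c₁ 1≤c₂ = proj₁ tree c
      (triangle (proj₂ (cell-inhabited 1≤c₀)) (proj₂ (cell-inhabited 1≤c₁)) (proj₂ (cell-inhabited 1≤c₂)))

    class-of-5-in-one-part : ∀ c → sum (cellSize c) ≡ 5 → ∀ p → cellSize c p % 5 ≡ 0
    class-of-5-in-one-part c size≡5 = in-one-part
      where
      x y z : ℕ
      x = cellSize c 0F
      y = cellSize c 1F
      z = cellSize c 2F
      x+y+z≡5 : x + (y + z) ≡ 5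
      x+y+z≡5 = trans (cong (λ w → x + (y + w)) (sym (+-identityʳ z))) size≡5
      in-one-part : ∀ p → cellSize c p % 5 ≡ 0
      in-one-part 0F = all-or-nothing x y z x+y+z≡5
        (not-rainbow c) (two-cells-≤4 (λ ())) (two-cells-≤4 (λ ()))
      in-one-part 1F = all-or-nothing y x z (trans (x∙yz≈y∙xz y x z) x+y+z≡5)
        (λ 1≤y 1≤x → not-rainbow c 1≤x 1≤y) (two-cells-≤4 (λ ())) (two-cells-≤4 (λ ()))
      in-one-part 2F = all-or-nothing z x y (trans (sym (x∙yz≈z∙xy x y z)) x+y+z≡5)
        (λ 1≤z 1≤x 1≤y → not-rainbow c 1≤x 1≤y 1≤z)
        (two-cells-≤4 (λ ())) (two-cells-≤4 (λ ()))

no-equitable-tree-coloring : ∀ n {T} → n % 5 ≡ 3 → 3 * n + 1 ≡ 5 * T →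
  ¬ HasEqTreeColoring (Ktri n) T 3
no-equitable-tree-coloring n n%5≡3 size (f , equitable , tree) =
  no-balanced-matrix n (cellSize {n} f) (s≤s (s≤s z≤n)) n%5≡3 size
    (∑cellSize≡n {n} f) balanced (class-of-5-in-one-part {n} f tree)
  where
  balanced : ∀ c d → sum (cellSize {n} f c) ≤ suc (sum (cellSize {n} f d))
  balanced c d = subst₂ (λ x y → x ≤ suc y)
    (classSize≡∑cellSize {n} f c) (classSize≡∑cellSize {n} f d) (equitable c d)

StrongEqBound⇒> : ∀ n {T} t → n % 5 ≡ 3 → 3 * n + 1 ≡ 5 * T →
  StrongEqBound (Ktri n) 3 t → T < t
StrongEqBound⇒> n {T} t n%5≡3 size bound with t ≤? T
... | yes t≤T = contradiction (bound T t≤T) (no-equitable-tree-coloring n n%5≡3 size)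
... | no t≰T  = ≰⇒> t≰T

lemma2 : ∀ (k : ℕ) → 1 ≤ k → k % 5 ≡ 2 →
  ∀ (t : ℕ) → StrongEqBound (Ktri (4 * k)) 3 t → 12 * k + 6 ≤ 5 * t
lemma2 k _ k%5≡2 t bound =
  subst (_≤ 5 * t) (sym 12k+6≡5[T+1])
    (*-monoʳ-≤ 5 (StrongEqBound⇒> (4 * k) {T} t 4k%5≡3 size bound))
  where
  j T : ℕ
  j = k / 5
  T = 5 + 12 * j
  k≡2+5j : k ≡ 2 + j * 5
  k≡2+5j = trans (m≡m%n+[m/n]*n k 5) (cong (_+ j * 5) k%5≡2)
  4k%5≡3 : 4 * k % 5 ≡ 3
  4k%5≡3 = trans (%-distribˡ-* 4 k 5) (cong (λ r → 4 * r % 5) k%5≡2)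
  size : 3 * (4 * k) + 1 ≡ 5 * T
  size = trans (cong (λ k → 3 * (4 * k) + 1) k≡2+5j) (size-identity j)
    where
    size-identity : ∀ j → 3 * (4 * (2 + j * 5)) + 1 ≡ 5 * (5 + 12 * j)
    size-identity = solve-∀
  12k+6≡5[T+1] : 12 * k + 6 ≡ 5 * suc T
  12k+6≡5[T+1] = trans (cong (λ k → 12 * k + 6) k≡2+5j) (bound-identity j)
    where
    bound-identity : ∀ j → 12 * (2 + j * 5) + 6 ≡ 5 * suc (5 + 12 * j)
    bound-identity = solve-∀
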